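{- Let $H=([n],E)$ be a hypergraph. Then the coloring complex $\Delta_H$ is connected if and only if for every pair of edges $F,F'\in E$ there is a sequence of edges $F=F_1,F_2,\dots,F_r=F'$ such that $F_i\cup F_{i+1}\neq[n]$ or $F_i\cap F_{i+1}=\emptyset$ for each $1\le i\le r-1$.
   Context: A hypergraph $H=([n],E)$ has vertex set $[n]$ and a set $E$ of subsets of $[n]$ (edges), with no edges of size at most $1$, no isolated vertices, and no edge properly contained in another. The coloring complex $\Delta_H$ is the simplicial complex whose vertex set is the set of nonempty proper subsets of $[n]$ and whose faces are the chains $\emptyset\ne A_1\subsetneq\cdots\subsetneq A_l\ne[n]$ ($l\ge0$) such that, with $A_0=\emptyset$, $A_{l+1}=[n]$, there exist $i$ and an edge $F\in E$ with $F\subseteq A_i\setminus A_{i-1}$ (equivalently: ordered set partitions of $[n]$ into nonempty blocks, at least one block containing an edge). -}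

module Defs where

open import Data.Nat using (ℕ; _≤_)
open import Data.Fin using (Fin)
open import Data.Fin.Subset using (Subset; _∈_; _⊆_; _⊂_; _∪_; _∩_; _─_; ⊥; ⊤; ∣_∣)
open import Data.List using (List; []; _∷_; _++_; [_])
open import Data.List.Membership.Propositional using () renaming (_∈_ to _∈ₗ_)
open import Data.List.Relation.Unary.All using (All)
open import Data.List.Relation.Unary.Any using (Any)
open import Data.Product using (Σ; ∃; _×_; _,_)
open import Data.Sum using (_⊎_)
open import Relation.Binary.PropositionalEquality using (_≡_)
open import Relation.Nullary using (¬_)
open import Relation.Binary.Construct.Closure.ReflexiveTransitive using (Star)

record Hypergraph (n : ℕ) : Set where
  field
    edges      : List (Subset n)
    edge-size  : ∀ {F} → F ∈ₗ edges → 2 ≤ ∣ F ∣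
    no-isolated : ∀ (v : Fin n) → ∃ λ F → F ∈ₗ edges × v ∈ F
    antichain  : ∀ {F G} → F ∈ₗ edges → G ∈ₗ edges → ¬ (F ⊂ G)
open Hypergraph public

consecutive : ∀ {A : Set} → List A → List (A × A)
consecutive []             = []
consecutive (x ∷ [])       = []
consecutive (x ∷ y ∷ xs)   = (x , y) ∷ consecutive (y ∷ xs)

padded : ∀ {n} → List (Subset n) → List (Subset n)
padded As = ⊥ ∷ (As ++ [ ⊤ ])

-- A list A_1,...,A_l is a face of the coloring complex Δ_H iff
-- ∅ ⊊ A_1 ⊊ ... ⊊ A_l ⊊ [n] (so each A_i is a nonempty proper subset), and
-- some difference A_i ∖ A_{i-1} (1 ≤ i ≤ l+1) contains an edge of H.
IsFace : ∀ {n} → Hypergraph n → List (Subset n) → Set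
IsFace H As =
  All (λ { (P , Q) → P ⊂ Q }) (consecutive (padded As)) ×
  Any (λ { (P , Q) → ∃ λ F → F ∈ₗ edges H × F ⊆ (Q ─ P) }) (consecutive (padded As))

IsVertex : ∀ {n} → Hypergraph n → Subset n → Set
IsVertex H A = IsFace H [ A ]

Adjacent : ∀ {n} → Hypergraph n → Subset n → Subset n → Set
Adjacent H A B = IsFace H (A ∷ B ∷ []) ⊎ IsFace H (B ∷ A ∷ [])

Connected : ∀ {n} → Hypergraph n → Set
Connected H = ∀ A B → IsVertex H A → IsVertex H B → Star (Adjacent H) A B

EdgeStep : ∀ {n} → Hypergraph n → Subset n → Subset n → Set
EdgeStep H F G = G ∈ₗ edges H × (¬ (F ∪ G ≡ ⊤) ⊎ F ∩ G ≡ ⊥)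

EdgeConnected : ∀ {n} → Hypergraph n → Set
EdgeConnected H = ∀ F F' → F ∈ₗ edges H → F' ∈ₗ edges H → Star (EdgeStep H) F F'

module Submission where

-- Call an edge G a witness of a set A if G ⊆ A or G ∩ A = ∅.  A vertex of Δ_H
-- is a nonempty proper subset A with a witness, and a 1-face A ⊊ B is a chain
-- with an edge inside one of the blocks A, B ∖ A, [n] ∖ B; such an edge is a
-- common witness of A and B.
--
-- (⇒) Two witnesses of the same vertex form one edge step, so a path in Δ_H
-- becomes a sequence of edges.  An edge equal to [n] is the only edge, by the
-- antichain condition.
-- (⇐) Edge-connectivity forces every edge F ≠ [n] to miss two points.  Then two
-- vertices A, B are joined in Δ_H when an edge lies inside both (through A ∩ B),
-- outside both (through A ∪ B), or outside A and inside B (through {a} and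
-- {a} ∪ F).  For a fixed vertex A, "A is joined to every proper superset of K"
-- holds for a witness K of A and propagates along edge steps to a witness of B.

open import Defs
open import Data.Nat using (ℕ; _≤_; s≤s)
open import Data.Nat.Properties using (≤-trans; ≤-reflexive)
open import Data.Fin using (zero; suc; _≟_)
open import Data.Fin.Properties using (any?)
open import Data.Fin.Subset using (Subset; inside; outside; _∈_; _∉_; _⊆_; _⊂_; _∪_; _∩_; _─_; ⊥; ⊤; ∣_∣; ⁅_⁆; Nonempty)
open import Data.Fin.Subset.Properties
  using (_∈?_; ⊆-refl; ⊆-antisym; ⊥⊆; ⊆⊤; ∈⊤; ∉⊥; Empty-unique; nonempty?; ∣⊥∣≡0; p⊆q⇒∣p∣≤∣q∣;
         p∩q⊆p; p∩q⊆q; x∈p∩q⁺; x∈p∩q⁻; p⊆p∪q; q⊆p∪q; x∈p∪q⁺; x∈p∪q⁻; p─q⊆p; x∈p∧x∉q⇒x∈p─q;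
         x∈⁅x⁆; x∈⁅y⁆⇒x≡y; x≢y⇒x∉⁅y⁆; ∣⁅x⁆∣≡1)
open import Data.Vec using (_∷_)
import Data.Vec.Base as Vec
open import Data.List using ([]; _∷_)
open import Data.List.Membership.Propositional using () renaming (_∈_ to _∈ₗ_)
open import Data.List.Relation.Unary.All using ([]; _∷_)
open import Data.List.Relation.Unary.Any using (here; there)
open import Data.Product using (∃; _×_; _,_; proj₁; proj₂)
open import Data.Sum using (_⊎_; inj₁; inj₂; [_,_]′)
open import Function using (_∘_)
open import Function.Bundles using (_⇔_; mk⇔)
open import Relation.Binary.PropositionalEquality using (_≡_; _≢_; refl; sym; subst)
open import Data.Empty using (⊥-elim)
open import Relation.Nullary using (¬_; yes; no; contradiction)
open import Relation.Nullary.Decidable using (_×-dec_; ¬?; decidable-stable)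
open import Relation.Binary.Construct.Closure.ReflexiveTransitive using (Star; ε; _◅_; _◅◅_; reverse)

Disjoint : ∀ {n} → Subset n → Subset n → Set
Disjoint F A = ∀ {x} → x ∈ F → x ∉ A

Proper : ∀ {n} → Subset n → Set
Proper A = Nonempty A × ∃ λ x → x ∉ A

x∈p─q⇒x∉q : ∀ {n} (p q : Subset n) {x} → x ∈ p ─ q → x ∉ q
x∈p─q⇒x∉q (_ ∷ _) (inside  ∷ _) {zero} ()
x∈p─q⇒x∉q (_ ∷ _) (outside ∷ _) {zero} _ ()
x∈p─q⇒x∉q (_ ∷ p) (_ ∷ q) {suc _} (Vec.there x∈p─q) (Vec.there x∈q) = x∈p─q⇒x∉q p q x∈p─q x∈q

⊆─⁻ : ∀ {n} {F Q P : Subset n} → F ⊆ Q ─ P → F ⊆ Q × Disjoint F P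
⊆─⁻ {Q = Q} {P} F⊆Q─P = p─q⊆p Q P ∘ F⊆Q─P , x∈p─q⇒x∉q Q P ∘ F⊆Q─P

⊆─⁺ : ∀ {n} {F Q P : Subset n} → F ⊆ Q → Disjoint F P → F ⊆ Q ─ P
⊆─⁺ F⊆Q F∩P=∅ x∈F = x∈p∧x∉q⇒x∈p─q (F⊆Q x∈F) (F∩P=∅ x∈F)

⊆-or-witness : ∀ {n} (P Q : Subset n) → P ⊆ Q ⊎ ∃ λ x → x ∈ P × x ∉ Q
⊆-or-witness P Q with any? (λ x → x ∈? P ×-dec ¬? (x ∈? Q))
... | yes counterexample = inj₂ counterexample
... | no  none           = inj₁ λ {x} x∈P → decidable-stable (x ∈? Q) (λ x∉Q → none (x , x∈P , x∉Q))

missing-or-full : ∀ {n} (p : Subset n) → (∃ λ x → x ∉ p) ⊎ (∀ x → x ∈ p)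
missing-or-full p with any? (λ x → ¬? (x ∈? p))
... | yes missing = inj₁ missing
... | no  none    = inj₂ λ x → decidable-stable (x ∈? p) (λ x∉p → none (x , x∉p))

missing⇒≢⊤ : ∀ {n} {p : Subset n} {x} → x ∉ p → p ≢ ⊤
missing⇒≢⊤ {x = x} x∉p p≡⊤ = x∉p (subst (x ∈_) (sym p≡⊤) ∈⊤)

≢⊤⇒missing : ∀ {n} {p : Subset n} → p ≢ ⊤ → ∃ λ x → x ∉ p
≢⊤⇒missing {p = p} p≢⊤ with missing-or-full p
... | inj₁ missing = missing
... | inj₂ full    = contradiction (⊆-antisym ⊆⊤ (λ {x} _ → full x)) p≢⊤

∪-avoids : ∀ {n} {p q : Subset n} {x} → x ∉ p → x ∉ q → x ∉ p ∪ q
∪-avoids {p = p} {q} x∉p x∉q = [ x∉p , x∉q ]′ ∘ x∈p∪q⁻ p q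

disjoint⇒∩≡⊥ : ∀ {n} {p q : Subset n} → Disjoint p q → p ∩ q ≡ ⊥
disjoint⇒∩≡⊥ {p = p} {q} p∩q=∅ = Empty-unique λ { (x , x∈p∩q) →
  let (x∈p , x∈q) = x∈p∩q⁻ p q x∈p∩q in p∩q=∅ x∈p x∈q }

∩≡⊥⇒disjoint : ∀ {n} {p q : Subset n} → p ∩ q ≡ ⊥ → Disjoint p q
∩≡⊥⇒disjoint p∩q≡⊥ {x} x∈p x∈q = ∉⊥ (subst (x ∈_) p∩q≡⊥ (x∈p∩q⁺ (x∈p , x∈q)))

two≤size⇒nonempty : ∀ {n} {F : Subset n} → 2 ≤ ∣ F ∣ → Nonempty F
two≤size⇒nonempty {n} {F} 2≤∣F∣ with nonempty? F
... | yes nonempty = nonempty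
... | no  empty    =
  contradiction (subst (2 ≤_) (∣⊥∣≡0 n) (subst (λ X → 2 ≤ ∣ X ∣) (Empty-unique empty) 2≤∣F∣)) λ ()

star-stuck : ∀ {A : Set} {R : A → A → Set} {x y} →
             (∀ {z} → R x z → z ≡ x) → Star R x y → y ≡ x
star-stuck stays ε        = refl
star-stuck stays (r ◅ rs) with stays r
... | refl = star-stuck stays rs

module _ {n : ℕ} (H : Hypergraph n) where

  Witness : Subset n → Subset n → Set
  Witness A G = G ∈ₗ edges H × (G ⊆ A ⊎ Disjoint G A)

  data InBlock (A B G : Subset n) : Set where
    first  : G ⊆ A → InBlock A B G
    middle : G ⊆ B → Disjoint G A → InBlock A B G
    last   : Disjoint G B → InBlock A B G

  _~_ : Subset n → Subset n → Set
  A ~ B = Star (Adjacent H) A B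

  ~-sym : ∀ {A B} → A ~ B → B ~ A
  ~-sym = reverse λ { (inj₁ face) → inj₂ face ; (inj₂ face) → inj₁ face }

  edge-nonempty : ∀ {F} → F ∈ₗ edges H → Nonempty F
  edge-nonempty F∈E = two≤size⇒nonempty (edge-size H F∈E)

  edge-⊆⇒≡ : ∀ {F G} → F ∈ₗ edges H → G ∈ₗ edges H → G ⊆ F → G ≡ F
  edge-⊆⇒≡ {F} {G} F∈E G∈E G⊆F with ⊆-or-witness F G
  ... | inj₁ F⊆G = ⊆-antisym G⊆F F⊆G
  ... | inj₂ new = contradiction ((λ {x} → G⊆F {x}) , new) (antichain H G∈E F∈E)

  edge-⊈⁅x⁆ : ∀ {F} x → F ∈ₗ edges H → ¬ (F ⊆ ⁅ x ⁆)
  edge-⊈⁅x⁆ x F∈E F⊆⁅x⁆ with ≤-trans (edge-size H F∈E)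
                               (≤-trans (p⊆q⇒∣p∣≤∣q∣ F⊆⁅x⁆) (≤-reflexive (∣⁅x⁆∣≡1 x)))
  ... | s≤s ()

  witness-proper : ∀ {A G} → Proper A → Witness A G → Proper G
  witness-proper (_ , x , x∉A) (G∈E , inj₁ G⊆A) = edge-nonempty G∈E , x , x∉A ∘ G⊆A
  witness-proper ((a , a∈A) , _) (G∈E , inj₂ G∩A=∅) = edge-nonempty G∈E , a , λ a∈G → G∩A=∅ a∈G a∈A

  vertex⇒witnessed : ∀ {A} → IsVertex H A → Proper A × ∃ (Witness A)
  vertex⇒witnessed (((_ , a , a∈A , _) ∷ (_ , x , _ , x∉A) ∷ []) , here (G , G∈E , G⊆A─⊥)) =
    ((a , a∈A) , x , x∉A) , G , G∈E , inj₁ (proj₁ (⊆─⁻ G⊆A─⊥))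
  vertex⇒witnessed (((_ , a , a∈A , _) ∷ (_ , x , _ , x∉A) ∷ []) , there (here (G , G∈E , G⊆⊤─A))) =
    ((a , a∈A) , x , x∉A) , G , G∈E , inj₂ (proj₂ (⊆─⁻ G⊆⊤─A))
  vertex⇒witnessed (_ , there (there ()))

  witnessed⇒vertex : ∀ {A G} → Proper A → Witness A G → IsVertex H A
  witnessed⇒vertex {G = G} ((a , a∈A) , x , x∉A) (G∈E , inj₁ G⊆A) =
    ((⊥⊆ , a , a∈A , ∉⊥) ∷ (⊆⊤ , x , ∈⊤ , x∉A) ∷ []) , here (G , G∈E , ⊆─⁺ G⊆A λ _ → ∉⊥)
  witnessed⇒vertex {G = G} ((a , a∈A) , x , x∉A) (G∈E , inj₂ G∩A=∅) =
    ((⊥⊆ , a , a∈A , ∉⊥) ∷ (⊆⊤ , x , ∈⊤ , x∉A) ∷ []) , there (here (G , G∈E , ⊆─⁺ ⊆⊤ G∩A=∅))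

  chain⇒adjacent : ∀ {A B G} → Proper A → Proper B → A ⊆ B → (∃ λ x → x ∈ B × x ∉ A) →
                   G ∈ₗ edges H → InBlock A B G → Adjacent H A B
  chain⇒adjacent {G = G} ((a , a∈A) , _) (_ , x , x∉B) A⊆B new G∈E (first G⊆A) =
    inj₁ (((⊥⊆ , a , a∈A , ∉⊥) ∷ (A⊆B , new) ∷ (⊆⊤ , x , ∈⊤ , x∉B) ∷ []) ,
          here (G , G∈E , ⊆─⁺ G⊆A λ _ → ∉⊥))
  chain⇒adjacent {G = G} ((a , a∈A) , _) (_ , x , x∉B) A⊆B new G∈E (middle G⊆B G∩A=∅) =
    inj₁ (((⊥⊆ , a , a∈A , ∉⊥) ∷ (A⊆B , new) ∷ (⊆⊤ , x , ∈⊤ , x∉B) ∷ []) ,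
          there (here (G , G∈E , ⊆─⁺ G⊆B G∩A=∅)))
  chain⇒adjacent {G = G} ((a , a∈A) , _) (_ , x , x∉B) A⊆B new G∈E (last G∩B=∅) =
    inj₁ (((⊥⊆ , a , a∈A , ∉⊥) ∷ (A⊆B , new) ∷ (⊆⊤ , x , ∈⊤ , x∉B) ∷ []) ,
          there (there (here (G , G∈E , ⊆─⁺ ⊆⊤ G∩B=∅))))

  chain-proper : ∀ {A B : Subset n} → ⊥ ⊂ A → A ⊆ B → B ⊂ ⊤ → Proper A × Proper B
  chain-proper (_ , a , a∈A , _) A⊆B (_ , x , _ , x∉B) = ((a , a∈A) , x , x∉B ∘ A⊆B) , (a , A⊆B a∈A) , x , x∉B

  face⇒shared-witness : ∀ {A B} → IsFace H (A ∷ B ∷ []) →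
                        (Proper A × Proper B) × ∃ λ K → Witness A K × Witness B K
  face⇒shared-witness ((⊥⊂A ∷ (A⊆B , _) ∷ B⊂⊤ ∷ []) , here (K , K∈E , K⊆A─⊥)) =
    let (K⊆A , _) = ⊆─⁻ K⊆A─⊥
    in chain-proper ⊥⊂A A⊆B B⊂⊤ , K , (K∈E , inj₁ K⊆A) , (K∈E , inj₁ (A⊆B ∘ K⊆A))
  face⇒shared-witness ((⊥⊂A ∷ (A⊆B , _) ∷ B⊂⊤ ∷ []) , there (here (K , K∈E , K⊆B─A))) =
    let (K⊆B , K∩A=∅) = ⊆─⁻ K⊆B─A
    in chain-proper ⊥⊂A A⊆B B⊂⊤ , K , (K∈E , inj₂ K∩A=∅) , (K∈E , inj₁ K⊆B)
  face⇒shared-witness ((⊥⊂A ∷ (A⊆B , _) ∷ B⊂⊤ ∷ []) , there (there (here (K , K∈E , K⊆⊤─B)))) =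
    let (_ , K∩B=∅) = ⊆─⁻ K⊆⊤─B
    in chain-proper ⊥⊂A A⊆B B⊂⊤ , K , (K∈E , inj₂ (λ k∈K → K∩B=∅ k∈K ∘ A⊆B)) , (K∈E , inj₂ K∩B=∅)
  face⇒shared-witness (_ , there (there (there ())))

  adjacent⇒shared-witness : ∀ {A B} → Adjacent H A B → Proper B × ∃ λ K → Witness A K × Witness B K
  adjacent⇒shared-witness (inj₁ face) with face⇒shared-witness face
  ... | (_ , pB) , K , wA , wB = pB , K , wA , wB
  adjacent⇒shared-witness (inj₂ face) with face⇒shared-witness face
  ... | (pB , _) , K , wB , wA = pB , K , wA , wB

  -- (⇒) From paths in Δ_H to edge sequences

  witnesses-step : ∀ {A G G'} → Proper A → Witness A G → Witness A G' → EdgeStep H G G'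
  witnesses-step (_ , x , x∉A) (_ , inj₁ G⊆A) (G'∈E , inj₁ G'⊆A) =
    G'∈E , inj₁ (missing⇒≢⊤ (∪-avoids (x∉A ∘ G⊆A) (x∉A ∘ G'⊆A)))
  witnesses-step ((a , a∈A) , _) (_ , inj₂ G∩A=∅) (G'∈E , inj₂ G'∩A=∅) =
    G'∈E , inj₁ (missing⇒≢⊤ (∪-avoids (λ a∈G → G∩A=∅ a∈G a∈A) (λ a∈G' → G'∩A=∅ a∈G' a∈A)))
  witnesses-step _ (_ , inj₁ G⊆A) (G'∈E , inj₂ G'∩A=∅) =
    G'∈E , inj₂ (disjoint⇒∩≡⊥ λ x∈G x∈G' → G'∩A=∅ x∈G' (G⊆A x∈G))
  witnesses-step _ (_ , inj₂ G∩A=∅) (G'∈E , inj₁ G'⊆A) =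
    G'∈E , inj₂ (disjoint⇒∩≡⊥ λ x∈G x∈G' → G∩A=∅ x∈G (G'⊆A x∈G'))

  -- Along a path in Δ_H, consecutive witnesses are linked through shared ones.
  path⇒edge-sequence : ∀ {A C G G'} → A ~ C → Proper A → Witness A G → Witness C G' →
                       Star (EdgeStep H) G G'
  path⇒edge-sequence ε pA wG wG' = witnesses-step pA wG wG' ◅ ε
  path⇒edge-sequence (adj ◅ path) pA wG wG' with adjacent⇒shared-witness adj
  ... | pB , K , wAK , wBK = witnesses-step pA wG wAK ◅ path⇒edge-sequence path pB wBK wG'

  -- A proper edge is a vertex witnessed by itself; an edge equal to [n]
  -- contains, hence equals, every edge.
  connected⇒edge-connected : Connected H → EdgeConnected H
  connected⇒edge-connected connected F F' F∈E F'∈E with missing-or-full F | missing-or-full F'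
  ... | inj₂ F-full | _ =
    subst (Star (EdgeStep H) F) (sym (edge-⊆⇒≡ F∈E F'∈E λ {x} _ → F-full x)) ε
  ... | inj₁ _ | inj₂ F'-full =
    subst (λ X → Star (EdgeStep H) X F') (sym (edge-⊆⇒≡ F'∈E F∈E λ {x} _ → F'-full x)) ε
  ... | inj₁ (x , x∉F) | inj₁ (x' , x'∉F') =
    path⇒edge-sequence (connected F F' (witnessed⇒vertex pF wF) (witnessed⇒vertex pF' wF')) pF wF wF'
    where
    pF : Proper F
    pF = edge-nonempty F∈E , x , x∉F
    pF' : Proper F'
    pF' = edge-nonempty F'∈E , x' , x'∉F'
    wF : Witness F F
    wF = F∈E , inj₁ ⊆-refl
    wF' : Witness F' F'
    wF' = F'∈E , inj₁ ⊆-refl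

  -- (⇐) Edge-connectivity makes every proper edge miss two points

  MissesTwo : Subset n → Set
  MissesTwo F = ∃ λ y → ∃ λ z → y ∉ F × z ∉ F × y ≢ z

  missing-other-than : ∀ {F} → MissesTwo F → ∀ a → ∃ λ z → z ∉ F × z ≢ a
  missing-other-than (y , y' , y∉F , y'∉F , y≢y') a with y ≟ a
  ... | yes refl = y' , y'∉F , y≢y' ∘ sym
  ... | no  y≢a  = y , y∉F , y≢a

  EdgesMissTwo : Set
  EdgesMissTwo = ∀ {F x} → F ∈ₗ edges H → x ∉ F → MissesTwo F

  -- An edge containing every point except possibly x is isolated: any edge G
  -- with F ∪ G ≠ [n] avoids x, hence lies in F; and G cannot avoid F.
  co-point-isolated : ∀ {F G} x → (∀ z → z ∉ F → z ≡ x) → F ∈ₗ edges H → EdgeStep H F G → G ≡ F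
  co-point-isolated {F} {G} x only-x F∈E (G∈E , inj₁ F∪G≢⊤) = edge-⊆⇒≡ F∈E G∈E G⊆F
    where
    x∉G : x ∉ G
    x∉G x∈G with ≢⊤⇒missing F∪G≢⊤
    ... | z , z∉F∪G with only-x z (z∉F∪G ∘ x∈p∪q⁺ ∘ inj₁)
    ...   | refl = z∉F∪G (x∈p∪q⁺ (inj₂ x∈G))
    G⊆F : G ⊆ F
    G⊆F {z} z∈G = decidable-stable (z ∈? F) λ z∉F → x∉G (subst (_∈ G) (only-x z z∉F) z∈G)
  co-point-isolated {F} {G} x only-x F∈E (G∈E , inj₂ F∩G≡⊥) = ⊥-elim (edge-⊈⁅x⁆ x G∈E G⊆⁅x⁆)
    where
    G⊆⁅x⁆ : G ⊆ ⁅ x ⁆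
    G⊆⁅x⁆ {z} z∈G = subst (_∈ ⁅ x ⁆) (sym (only-x z λ z∈F → ∩≡⊥⇒disjoint F∩G≡⊥ z∈F z∈G)) (x∈⁅x⁆ x)

  -- If F missed only x, the edge through x given by no-isolated would be
  -- reachable from F and hence equal to F.
  edge-connected⇒misses-two : EdgeConnected H → EdgesMissTwo
  edge-connected⇒misses-two connected {F} {x} F∈E x∉F with any? (λ z → ¬? (z ∈? F) ×-dec ¬? (z ≟ x))
  ... | yes (z , z∉F , z≢x) = x , z , x∉F , z∉F , z≢x ∘ sym
  ... | no  no-other with no-isolated H x
  ...   | G , G∈E , x∈G = ⊥-elim (x∉F (subst (x ∈_) G≡F x∈G))
    where
    only-x : ∀ z → z ∉ F → z ≡ x
    only-x z z∉F = decidable-stable (z ≟ x) λ z≢x → no-other (z , z∉F , z≢x)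
    G≡F : G ≡ F
    G≡F = star-stuck (co-point-isolated x only-x F∈E) (connected F G F∈E G∈E)

  -- (⇐) Joining vertices of Δ_H through an edge

  nested⇒joined : ∀ {A B G} → Proper A → Proper B → A ⊆ B → G ∈ₗ edges H → InBlock A B G → A ~ B
  nested⇒joined {A} {B} pA pB A⊆B G∈E block with ⊆-or-witness B A
  ... | inj₁ B⊆A = subst (A ~_) (⊆-antisym A⊆B B⊆A) ε
  ... | inj₂ new = chain⇒adjacent pA pB A⊆B new G∈E block ◅ ε

  -- An edge inside A and B: go down to A ∩ B and back up.
  inside-both⇒joined : ∀ {A B F} → F ∈ₗ edges H → F ⊆ A → F ⊆ B → Proper A → Proper B → A ~ B
  inside-both⇒joined {A} {B} {F} F∈E F⊆A F⊆B pA@(_ , x , x∉A) pB =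
    ~-sym (nested⇒joined pA∩B pA (p∩q⊆p A B) F∈E (first F⊆A∩B)) ◅◅
    nested⇒joined pA∩B pB (p∩q⊆q A B) F∈E (first F⊆A∩B)
    where
    F⊆A∩B : F ⊆ A ∩ B
    F⊆A∩B f∈F = x∈p∩q⁺ (F⊆A f∈F , F⊆B f∈F)
    pA∩B : Proper (A ∩ B)
    pA∩B = let (f , f∈F) = edge-nonempty F∈E in (f , F⊆A∩B f∈F) , x , x∉A ∘ p∩q⊆p A B

  -- An edge outside A and B: go up to A ∪ B and back down.
  outside-both⇒joined : ∀ {A B F} → F ∈ₗ edges H → Disjoint F A → Disjoint F B →
                        Proper A → Proper B → A ~ B
  outside-both⇒joined {A} {B} {F} F∈E F∩A=∅ F∩B=∅ pA@((a , a∈A) , _) pB =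
    nested⇒joined pA pA∪B (p⊆p∪q B) F∈E (last F∩A∪B=∅) ◅◅
    ~-sym (nested⇒joined pB pA∪B (q⊆p∪q A B) F∈E (last F∩A∪B=∅))
    where
    F∩A∪B=∅ : Disjoint F (A ∪ B)
    F∩A∪B=∅ f∈F = ∪-avoids (F∩A=∅ f∈F) (F∩B=∅ f∈F)
    pA∪B : Proper (A ∪ B)
    pA∪B = let (f , f∈F) = edge-nonempty F∈E in (a , p⊆p∪q B a∈A) , f , F∩A∪B=∅ f∈F

  -- An edge F outside A and inside B, missing two points: pass from A to a
  -- singleton {a} ⊆ A (both avoid F), then to {a} ∪ F (F is its middle block;
  -- it misses a point z ≠ a), then to B (both contain F).
  outside-inside⇒joined : ∀ {A B F} → MissesTwo F → F ∈ₗ edges H → Disjoint F A → F ⊆ B →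
                          Proper A → Proper B → A ~ B
  outside-inside⇒joined {A} {B} {F} two F∈E F∩A=∅ F⊆B pA@((a , a∈A) , _) pB with missing-other-than two a
  ... | z , z∉F , z≢a =
    outside-both⇒joined F∈E F∩A=∅ F∩⁅a⁆=∅ pA p⁅a⁆ ◅◅
    nested⇒joined p⁅a⁆ p⁅a⁆∪F (p⊆p∪q F) F∈E (middle (q⊆p∪q ⁅ a ⁆ F) F∩⁅a⁆=∅) ◅◅
    inside-both⇒joined F∈E (q⊆p∪q ⁅ a ⁆ F) F⊆B p⁅a⁆∪F pB
    where
    F∩⁅a⁆=∅ : Disjoint F ⁅ a ⁆
    F∩⁅a⁆=∅ f∈F f∈⁅a⁆ = F∩A=∅ f∈F (subst (_∈ A) (sym (x∈⁅y⁆⇒x≡y a f∈⁅a⁆)) a∈A)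
    p⁅a⁆ : Proper ⁅ a ⁆
    p⁅a⁆ = (a , x∈⁅x⁆ a) , z , x≢y⇒x∉⁅y⁆ z≢a
    p⁅a⁆∪F : Proper (⁅ a ⁆ ∪ F)
    p⁅a⁆∪F = (a , p⊆p∪q F (x∈⁅x⁆ a)) , z , ∪-avoids (x≢y⇒x∉⁅y⁆ z≢a) z∉F

  -- (⇐) Propagating connectivity along edge steps

  JoinedAbove : Subset n → Subset n → Set
  JoinedAbove A K = ∀ {B} → K ⊆ B → Proper B → A ~ B

  -- The disjoint cases below need edges to miss two points.
  module _ (missesTwo : EdgesMissTwo) where

    witness⇒joined-above : ∀ {A K} → Proper A → Witness A K → JoinedAbove A K
    witness⇒joined-above pA (K∈E , inj₁ K⊆A) K⊆B pB = inside-both⇒joined K∈E K⊆A K⊆B pA pB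
    witness⇒joined-above pA@((a , a∈A) , _) (K∈E , inj₂ K∩A=∅) K⊆B pB =
      outside-inside⇒joined (missesTwo K∈E λ a∈K → K∩A=∅ a∈K a∈A) K∈E K∩A=∅ K⊆B pA pB

    -- If K ∪ K' ≠ [n], pass through the proper set K ∪ K'; if K ∩ K' = ∅,
    -- pass through K itself, which lies outside K'.
    joined-above-step : ∀ {A K K'} → K ∈ₗ edges H → EdgeStep H K K' → JoinedAbove A K → JoinedAbove A K'
    joined-above-step {K = K} {K'} K∈E (K'∈E , inj₁ K∪K'≢⊤) joined K'⊆B pB =
      joined (p⊆p∪q K') pK∪K' ◅◅ inside-both⇒joined K'∈E (q⊆p∪q K K') K'⊆B pK∪K' pB
      where
      pK∪K' : Proper (K ∪ K')
      pK∪K' = let (k , k∈K) = edge-nonempty K∈E in (k , p⊆p∪q K' k∈K) , ≢⊤⇒missing K∪K'≢⊤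
    joined-above-step {K = K} {K'} K∈E (K'∈E , inj₂ K∩K'≡⊥) joined K'⊆B pB
      with edge-nonempty K∈E | edge-nonempty K'∈E
    ... | k , k∈K | k' , k'∈K' =
      joined ⊆-refl pK ◅◅
      outside-inside⇒joined (missesTwo K'∈E λ k∈K' → K'∩K=∅ k∈K' k∈K) K'∈E K'∩K=∅ K'⊆B pK pB
      where
      K'∩K=∅ : Disjoint K' K
      K'∩K=∅ x∈K' x∈K = ∩≡⊥⇒disjoint K∩K'≡⊥ x∈K x∈K'
      pK : Proper K
      pK = (k , k∈K) , k' , K'∩K=∅ k'∈K'

    joined-above-along : ∀ {A K K'} → K ∈ₗ edges H → Star (EdgeStep H) K K' →
                         JoinedAbove A K → JoinedAbove A K'
    joined-above-along K∈E ε                 joined = joined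
    joined-above-along K∈E (step ◅ sequence) joined =
      joined-above-along (proj₁ step) sequence (joined-above-step K∈E step joined)

  -- Join A above a witness F, carry this along an edge sequence to a witness G
  -- of B; the proper set G itself is then joined to A and, by symmetry, to B.
  edge-connected⇒connected : EdgeConnected H → Connected H
  edge-connected⇒connected connected A B vA vB with vertex⇒witnessed vA | vertex⇒witnessed vB
  ... | pA , F , wF | pB , G , wG =
    joined-above-along missesTwo (proj₁ wF) (connected F G (proj₁ wF) (proj₁ wG))
      (witness⇒joined-above missesTwo pA wF) ⊆-refl pG ◅◅
    ~-sym (witness⇒joined-above missesTwo pB wG ⊆-refl pG)
    where
    missesTwo : EdgesMissTwo
    missesTwo = edge-connected⇒misses-two connected
    pG : Proper G
    pG = witness-proper pB wG

proposition5p5 : ∀ (n : ℕ) (H : Hypergraph n) → Connected H ⇔ EdgeConnected H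
proposition5p5 n H = mk⇔ (connected⇒edge-connected H) (edge-connected⇒connected H)
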